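{- If $\Gamma$ is a distance-biregular graph on $n$ vertices with the $M$-property and $D_0\ge 2$, then $n<2k_1+k_0$.
   Context: Graphs are finite, connected, simple, $n=|V|\ge2$, $d$ the graph distance, $\Gamma_i(x)=\{y:d(x,y)=i\}$. $\mathsf L$ is the combinatorial Laplacian matrix and $\mathsf L^\#$ its group inverse. $\Gamma$ has the $M$-property if $\mathsf L^\#(x,y)\le 0$ for all $x\ne y$. A distance-biregular graph is a connected bipartite graph with stable sets $V_0,V_1$, every vertex in $V_\ell$ of degree $k_\ell$, such that for vertices $x,y$ at distance $i$ the numbers $|\Gamma_{i-1}(x)\cap\Gamma_1(y)|$ and $|\Gamma_{i+1}(x)\cap\Gamma_1(y)|$ depend only on $i$ and the stable set of $x$. $D_\ell=\max\{d(x,y):x\in V_\ell,y\in V\}$, with the labelling of the stable sets chosen so that $D_0\le D_1$. -}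

module Defs where

open import Data.Nat as ℕ using (ℕ; zero; suc; _⊔_)
open import Data.Bool using (Bool; true; false; _∧_; _∨_; not; if_then_else_)
open import Data.Fin using (Fin; zero; suc)
open import Data.Fin.Properties using (_≟_)
open import Data.Integer using (+_)
open import Data.Rational using (ℚ; _/_; _+_; _*_; -_; 0ℚ; 1ℚ)
open import Data.Rational as Q using ()
open import Data.Product using (Σ; _×_; ∃; ∃-syntax)
open import Relation.Nullary using (¬_)
open import Relation.Nullary.Decidable using (⌊_⌋)
open import Relation.Binary.PropositionalEquality using (_≡_; _≢_)

∑ : ∀ {n} → (Fin n → ℚ) → ℚ
∑ {zero}  f = 0ℚ
∑ {suc n} f = f zero + ∑ (λ i → f (suc i))

count : ∀ {n} → (Fin n → Bool) → ℕ
count {zero}  p = 0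
count {suc n} p = (if p zero then 1 else 0) ℕ.+ count (λ i → p (suc i))

countBelow : ℕ → (ℕ → Bool) → ℕ
countBelow zero    p = 0
countBelow (suc m) p = countBelow m p ℕ.+ (if p m then 1 else 0)

maxOver : ∀ {n} → (Fin n → Bool) → (Fin n → ℕ) → ℕ
maxOver {zero}  p f = 0
maxOver {suc n} p f =
  (if p zero then f zero else 0) ⊔ maxOver (λ i → p (suc i)) (λ i → f (suc i))

anyFin : ∀ {n} → (Fin n → Bool) → Bool
anyFin {zero}  p = false
anyFin {suc n} p = p zero ∨ anyFin (λ i → p (suc i))

_==_ : ∀ {n} → Fin n → Fin n → Bool
x == y = ⌊ x ≟ y ⌋

record Graph (n : ℕ) : Set where
  field
    adj     : Fin n → Fin n → Bool
    sym     : ∀ x y → adj x y ≡ adj y x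
    irrefl  : ∀ x → adj x x ≡ false
open Graph public

module _ {n : ℕ} (G : Graph n) where

  Within : ℕ → Fin n → Fin n → Bool
  Within zero    x y = x == y
  Within (suc k) x y = Within k x y ∨ anyFin (λ z → Within k x z ∧ adj G z y)

  Connected : Set
  Connected = ∀ x y → ∃[ k ] (Within k x y ≡ true)

  -- graph distance: the least k with y within k steps of x
  -- (= number of k < n with y not within k steps; correct for connected graphs,
  --  where every distance is < n)
  dist : Fin n → Fin n → ℕ
  dist x y = countBelow n (λ k → not (Within k x y))

  degree : Fin n → ℕ
  degree x = count (adj G x)

  countΓ : ℕ → Fin n → Fin n → ℕ
  countΓ i x y = count (λ z → ⌊ dist x z ℕ.≟ i ⌋ ∧ adj G y z)

  Laplacian : Fin n → Fin n → ℚ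
  Laplacian x y =
    if x == y then (+ degree x / 1)
    else (if adj G x y then - 1ℚ else 0ℚ)

Matrix : ℕ → Set
Matrix n = Fin n → Fin n → ℚ

infixl 7 _⊗_
infix 4 _≐_
_⊗_ : ∀ {n} → Matrix n → Matrix n → Matrix n
(A ⊗ B) x y = ∑ (λ z → A x z * B z y)

_≐_ : ∀ {n} → Matrix n → Matrix n → Set
A ≐ B = ∀ x y → A x y ≡ B x y

IsGroupInverse : ∀ {n} → Matrix n → Matrix n → Set
IsGroupInverse A X = ((A ⊗ X) ⊗ A ≐ A) × ((X ⊗ A) ⊗ X ≐ X) × (A ⊗ X ≐ X ⊗ A)

-- M-property: L^#(x,y) ≤ 0 for all x ≠ y (the group inverse is unique)
MProperty : ∀ {n} → Graph n → Set
MProperty {n} G =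
  Σ (Matrix n) λ X → IsGroupInverse (Laplacian G) X × (∀ x y → x ≢ y → X x y Q.≤ 0ℚ)

record DistanceBiregular {n : ℕ} (G : Graph n) (part : Fin n → Fin 2)
                         (k : Fin 2 → ℕ) : Set where
  field
    connected : Connected G
    bipartite : ∀ x y → adj G x y ≡ true → part x ≢ part y
    regular   : ∀ x → degree G x ≡ k (part x)
    c b       : Fin 2 → ℕ → ℕ
    c-const   : ∀ x y → 1 ℕ.≤ dist G x y →
                countΓ G (ℕ.pred (dist G x y)) x y ≡ c (part x) (dist G x y)
    b-const   : ∀ x y →
                countΓ G (suc (dist G x y)) x y ≡ b (part x) (dist G x y)

Dmax : ∀ {n} → Graph n → (Fin n → Fin 2) → Fin 2 → ℕ
Dmax G part ℓ = maxOver (λ x → part x == ℓ) (λ x → maxOver (λ _ → true) (dist G x))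

module Submission where

-- Fix y ∈ V₁ with a neighbour and write N = n, K = k₁ = deg y, K₀ = k₀. For a connected graph
-- L L^# = I − J/N, so u = N·L^#(·, y) satisfies L u = N e_y − 1 and Σ u = 0, and the M-property
-- makes u ≤ 0 off y; reading L u at y then gives K u(y) ≤ N − 1. The Laplacian form is positive
-- semidefinite, so ⟨h, L h⟩ ≥ 0 for h = f − l u with the star vector f = t₀ e_y + t₁ 1_{Γ(y)}.
-- Since Γ(y) ⊆ V₀ is independent and its vertices all have degree K₀, the three entries of the
-- form are explicit, and for t₁ = N − 1, t₀ = (N − 1)(K₀ + 1), l = K K₀ the inequality fails
-- as soon as N ≥ 2K + K₀.

open import Defs hiding (sym)
open import Algebra.Bundles using (CommutativeRing)
open import Data.Bool using (Bool; true; false; if_then_else_; _∧_)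
open import Data.Bool.Properties using (∧-conicalˡ; ∧-conicalʳ)
open import Data.Empty using (⊥-elim)
open import Data.Fin using (Fin; zero; suc)
open import Data.Fin.Properties using (_≟_; suc-injective)
open import Data.Integer as ℤ using ()
import Data.Integer.Properties as ℤP
open import Data.Nat as ℕ using (ℕ; zero; suc)
import Data.Nat.Properties as ℕP
open import Data.Product using (∃; _×_; _,_; proj₁; proj₂)
open import Data.Rational
  using (ℚ; 0ℚ; 1ℚ; ½; _/_; _+_; _*_; -_; _-_; _≤_; _<_; toℚᵘ; nonNegative; nonPositive; positive; negative)
import Data.Rational.Properties as QP
open import Data.Rational.Solver using (module +-*-Solver)
open import Data.Rational.Unnormalised as ℚᵘ using (mkℚᵘ; *≡*)
import Data.Rational.Unnormalised.Properties as ℚᵘP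
open import Data.Sum using (_⊎_; inj₁; inj₂)
open import Function using (_∘_)
open import Relation.Binary using (tri<; tri≈; tri>)
open import Relation.Binary.PropositionalEquality
open import Relation.Nullary using (¬_; yes; no; contradiction)

import Algebra.Properties.Semiring.Sum (CommutativeRing.semiring QP.+-*-commutativeRing) as Sum
open +-*-Solver

-- The same expression as the diagonal entries of `Laplacian`, so ι (degree G x) is one definitionally.
ι : ℕ → ℚ
ι m = ℤ.+ m / 1

ι-nonNeg : ∀ m → 0ℚ ≤ ι m
ι-nonNeg m = QP.nonNegative⁻¹ (ι m) {{QP.normalize-nonNeg m 1}}

ι-+ : ∀ m k → ι (m ℕ.+ k) ≡ ι m + ι k
ι-+ m k = QP.toℚᵘ-injective (begin
  toℚᵘ (ι (m ℕ.+ k))                  ≈⟨ QP.toℚᵘ-fromℚᵘ (mkℚᵘ (ℤ.+ (m ℕ.+ k)) 0) ⟩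
  mkℚᵘ (ℤ.+ (m ℕ.+ k)) 0              ≈⟨ *≡* (cong (ℤ._* ℤ.+ 1) (sym (cong₂ ℤ._+_ (ℤP.*-identityʳ (ℤ.+ m))
                                                                                (ℤP.*-identityʳ (ℤ.+ k))))) ⟩
  mkℚᵘ (ℤ.+ m) 0 ℚᵘ.+ mkℚᵘ (ℤ.+ k) 0  ≈⟨ ℚᵘP.+-cong (QP.toℚᵘ-fromℚᵘ (mkℚᵘ (ℤ.+ m) 0))
                                                    (QP.toℚᵘ-fromℚᵘ (mkℚᵘ (ℤ.+ k) 0)) ⟨
  toℚᵘ (ι m) ℚᵘ.+ toℚᵘ (ι k)          ≈⟨ QP.toℚᵘ-homo-+ (ι m) (ι k) ⟨
  toℚᵘ (ι m + ι k)                    ∎)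
  where open ℚᵘP.≃-Reasoning

ι-suc : ∀ m → ι (suc m) ≡ 1ℚ + ι m
ι-suc = ι-+ 1

ι-mono-≤ : ∀ {m k} → m ℕ.≤ k → ι m ≤ ι k
ι-mono-≤ {m} {k} m≤k = begin
  ι m                  ≡⟨ QP.+-identityʳ (ι m) ⟨
  ι m + 0ℚ             ≤⟨ QP.+-monoʳ-≤ (ι m) (ι-nonNeg (k ℕ.∸ m)) ⟩
  ι m + ι (k ℕ.∸ m)    ≡⟨ ι-+ m (k ℕ.∸ m) ⟨
  ι (m ℕ.+ (k ℕ.∸ m))  ≡⟨ cong ι (ℕP.m+[n∸m]≡n m≤k) ⟩
  ι k                  ∎
  where open QP.≤-Reasoning

≤⇒0≤- : ∀ {p q} → p ≤ q → 0ℚ ≤ q - p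
≤⇒0≤- {p} {q} p≤q = subst (_≤ q - p) (QP.+-inverseʳ p) (QP.+-monoˡ-≤ (- p) p≤q)

*-nonNeg : ∀ {p q} → 0ℚ ≤ p → 0ℚ ≤ q → 0ℚ ≤ p * q
*-nonNeg {p} {q} 0≤p 0≤q =
  QP.nonNegative⁻¹ _ {{QP.nonNeg*nonNeg⇒nonNeg p {{nonNegative 0≤p}} q {{nonNegative 0≤q}}}}

*-pos : ∀ {p q} → 0ℚ < p → 0ℚ < q → 0ℚ < p * q
*-pos {p} {q} 0<p 0<q = QP.positive⁻¹ _ {{QP.pos*pos⇒pos p {{positive 0<p}} q {{positive 0<q}}}}

pos+nonNeg⇒pos : ∀ {p q} → 0ℚ < p → 0ℚ ≤ q → 0ℚ < p + q
pos+nonNeg⇒pos {p} {q} 0<p 0≤q = QP.positive⁻¹ _ {{QP.pos+nonNeg⇒pos p {{positive 0<p}} q {{nonNegative 0≤q}}}}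

nonNeg+nonNeg≡0⇒≡0 : ∀ {p q} → 0ℚ ≤ p → 0ℚ ≤ q → p + q ≡ 0ℚ → p ≡ 0ℚ
nonNeg+nonNeg≡0⇒≡0 {p} {q} 0≤p 0≤q p+q≡0 = QP.≤-antisym p≤0 0≤p
  where
  open QP.≤-Reasoning
  p≤0 : p ≤ 0ℚ
  p≤0 = begin
    p       ≡⟨ QP.+-identityʳ p ⟨
    p + 0ℚ  ≤⟨ QP.+-monoʳ-≤ p 0≤q ⟩
    p + q   ≡⟨ p+q≡0 ⟩
    0ℚ      ∎

0≤x*x : ∀ x → 0ℚ ≤ x * x
0≤x*x x with QP.≤-total 0ℚ x
... | inj₁ 0≤x = *-nonNeg 0≤x 0≤x
... | inj₂ x≤0 = QP.nonNegative⁻¹ _ {{QP.nonPos*nonPos⇒nonPos x {{nonPositive x≤0}} x {{nonPositive x≤0}}}}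

x*x≡0⇒x≡0 : ∀ x → x * x ≡ 0ℚ → x ≡ 0ℚ
x*x≡0⇒x≡0 x x*x≡0 with QP.<-cmp x 0ℚ
... | tri≈ _ x≡0 _ = x≡0
... | tri< x<0 _ _ = ⊥-elim (QP.<-irrefl (sym x*x≡0)
        (QP.positive⁻¹ _ {{QP.neg*neg⇒pos x {{negative x<0}} x {{negative x<0}}}}))
... | tri> _ _ x>0 = ⊥-elim (QP.<-irrefl (sym x*x≡0)
        (QP.positive⁻¹ _ {{QP.pos*pos⇒pos x {{positive x>0}} x {{positive x>0}}}}))

∑≡sum : ∀ {n} (f : Fin n → ℚ) → ∑ f ≡ Sum.sum f
∑≡sum {zero}  f = refl
∑≡sum {suc n} f = cong (f zero +_) (∑≡sum (f ∘ suc))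

∑-cong : ∀ {n} {f g : Fin n → ℚ} → (∀ i → f i ≡ g i) → ∑ f ≡ ∑ g
∑-cong {f = f} {g} f≗g = trans (∑≡sum f) (trans (Sum.sum-cong-≗ f≗g) (sym (∑≡sum g)))

∑-zero : ∀ n → ∑ {n} (λ _ → 0ℚ) ≡ 0ℚ
∑-zero n = trans (∑≡sum {n} (λ _ → 0ℚ)) (Sum.sum-replicate-zero n)

∑-+ : ∀ {n} (f g : Fin n → ℚ) → ∑ (λ i → f i + g i) ≡ ∑ f + ∑ g
∑-+ f g = trans (∑≡sum (λ i → f i + g i))
                (trans (Sum.∑-distrib-+ f g) (sym (cong₂ _+_ (∑≡sum f) (∑≡sum g))))

∑-neg : ∀ {n} (f : Fin n → ℚ) → ∑ (λ i → - f i) ≡ - ∑ f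
∑-neg {zero}  f = refl
∑-neg {suc n} f = trans (cong (- f zero +_) (∑-neg (f ∘ suc)))
                        (sym (QP.neg-distrib-+ (f zero) (∑ (f ∘ suc))))

∑-sub : ∀ {n} (f g : Fin n → ℚ) → ∑ (λ i → f i - g i) ≡ ∑ f - ∑ g
∑-sub f g = trans (∑-+ f (λ i → - g i)) (cong (∑ f +_) (∑-neg g))

∑-*ˡ : ∀ {n} (a : ℚ) (f : Fin n → ℚ) → ∑ (λ i → a * f i) ≡ a * ∑ f
∑-*ˡ a f = trans (∑≡sum (λ i → a * f i)) (sym (trans (cong (a *_) (∑≡sum f)) (Sum.*-distribˡ-sum a f)))

∑-*ʳ : ∀ {n} (a : ℚ) (f : Fin n → ℚ) → ∑ (λ i → f i * a) ≡ ∑ f * a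
∑-*ʳ a f = trans (∑≡sum (λ i → f i * a)) (sym (trans (cong (_* a) (∑≡sum f)) (Sum.*-distribʳ-sum a f)))

∑-linear : ∀ {n} (a b : ℚ) (f g : Fin n → ℚ) → ∑ (λ i → a * f i + b * g i) ≡ a * ∑ f + b * ∑ g
∑-linear a b f g = trans (∑-+ (λ i → a * f i) (λ i → b * g i)) (cong₂ _+_ (∑-*ˡ a f) (∑-*ˡ b g))

∑-comm : ∀ {m n} (f : Fin m → Fin n → ℚ) → ∑ (λ i → ∑ (f i)) ≡ ∑ (λ j → ∑ (λ i → f i j))
∑-comm f = begin
  ∑ (λ i → ∑ (f i))                      ≡⟨ ∑∑≡sumsum f ⟩
  Sum.sum (λ i → Sum.sum (f i))          ≡⟨ Sum.∑-comm f ⟩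
  Sum.sum (λ j → Sum.sum (λ i → f i j))  ≡⟨ ∑∑≡sumsum (λ j i → f i j) ⟨
  ∑ (λ j → ∑ (λ i → f i j))              ∎
  where
  open ≡-Reasoning
  ∑∑≡sumsum : ∀ {m n} (g : Fin m → Fin n → ℚ) → ∑ (λ i → ∑ (g i)) ≡ Sum.sum (λ i → Sum.sum (g i))
  ∑∑≡sumsum g = trans (∑-cong (λ i → ∑≡sum (g i))) (∑≡sum (λ i → Sum.sum (g i)))

∑-const : ∀ n (a : ℚ) → ∑ {n} (λ _ → a) ≡ ι n * a
∑-const zero    a = sym (QP.*-zeroˡ a)
∑-const (suc n) a = begin
  a + ∑ {n} (λ _ → a)  ≡⟨ cong (a +_) (∑-const n a) ⟩
  a + ι n * a          ≡⟨ solve 2 (λ a m → a :+ m :* a := (con 1ℚ :+ m) :* a) refl a (ι n) ⟩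
  (1ℚ + ι n) * a       ≡⟨ cong (_* a) (ι-suc n) ⟨
  ι (suc n) * a        ∎
  where open ≡-Reasoning

∑-mono-≤ : ∀ {n} {f g : Fin n → ℚ} → (∀ i → f i ≤ g i) → ∑ f ≤ ∑ g
∑-mono-≤ {zero}  f≤g = QP.≤-refl
∑-mono-≤ {suc n} f≤g = QP.+-mono-≤ (f≤g zero) (∑-mono-≤ (f≤g ∘ suc))

∑-nonNeg : ∀ {n} {f : Fin n → ℚ} → (∀ i → 0ℚ ≤ f i) → 0ℚ ≤ ∑ f
∑-nonNeg {n} {f} 0≤f = subst (_≤ ∑ f) (∑-zero n) (∑-mono-≤ 0≤f)

∑-nonNeg-≡0 : ∀ {n} {f : Fin n → ℚ} → (∀ i → 0ℚ ≤ f i) → ∑ f ≡ 0ℚ → ∀ i → f i ≡ 0ℚ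
∑-nonNeg-≡0 {suc n} {f} 0≤f ∑f≡0 zero    = nonNeg+nonNeg≡0⇒≡0 (0≤f zero) (∑-nonNeg (0≤f ∘ suc)) ∑f≡0
∑-nonNeg-≡0 {suc n} {f} 0≤f ∑f≡0 (suc i) = ∑-nonNeg-≡0 (0≤f ∘ suc) ∑tail≡0 i
  where
  ∑tail≡0 : ∑ (f ∘ suc) ≡ 0ℚ
  ∑tail≡0 = nonNeg+nonNeg≡0⇒≡0 (∑-nonNeg (0≤f ∘ suc)) (0≤f zero)
                                (trans (QP.+-comm (∑ (f ∘ suc)) (f zero)) ∑f≡0)

𝟙 : Bool → ℚ
𝟙 b = if b then 1ℚ else 0ℚ

𝟙-nonNeg : ∀ b → 0ℚ ≤ 𝟙 b
𝟙-nonNeg true  = QP.nonNegative⁻¹ 1ℚ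
𝟙-nonNeg false = QP.≤-refl

count-pos : ∀ {n} (p : Fin n → Bool) {i : Fin n} → p i ≡ true → 1 ℕ.≤ count p
count-pos p         {zero}  pi rewrite pi = ℕ.s≤s ℕ.z≤n
count-pos {suc n} p {suc i} pi = ℕP.≤-trans (count-pos (p ∘ suc) pi) (ℕP.m≤n+m _ _)

ι-count : ∀ {n} (p : Fin n → Bool) → ι (count p) ≡ ∑ (𝟙 ∘ p)
ι-count {zero}  p = refl
ι-count {suc n} p with p zero
... | true  = trans (ι-suc (count (p ∘ suc))) (cong (1ℚ +_) (ι-count (p ∘ suc)))
... | false = trans (ι-count (p ∘ suc)) (sym (QP.+-identityˡ (∑ (𝟙 ∘ p ∘ suc))))

δ : ∀ {n} → Fin n → Fin n → ℚ
δ x y = 𝟙 (x == y)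

δ-diag : ∀ {n} (x : Fin n) → δ x x ≡ 1ℚ
δ-diag x with x ≟ x
... | yes _   = refl
... | no x≢x = contradiction refl x≢x

δ-offdiag : ∀ {n} {x y : Fin n} → x ≢ y → δ x y ≡ 0ℚ
δ-offdiag {x = x} {y} x≢y with x ≟ y
... | yes x≡y = contradiction x≡y x≢y
... | no _    = refl

δ-sym : ∀ {n} (x y : Fin n) → δ x y ≡ δ y x
δ-sym x y with x ≟ y
... | yes refl = sym (δ-diag x)
... | no x≢y   = sym (δ-offdiag (x≢y ∘ sym))

δ-suc : ∀ {n} (x y : Fin n) → δ (suc x) (suc y) ≡ δ x y
δ-suc x y with x ≟ y | suc x ≟ suc y
... | yes _   | yes _     = refl
... | no _    | no _      = refl
... | yes x≡y | no sx≢sy  = contradiction (cong suc x≡y) sx≢sy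
... | no x≢y  | yes sx≡sy = contradiction (suc-injective sx≡sy) x≢y

*-δ-sym : ∀ {n} (h : Fin n → ℚ) (x z : Fin n) → h x * δ x z ≡ h z * δ z x
*-δ-sym h x z with x ≟ z
... | yes refl = cong (h x *_) (sym (δ-diag x))
... | no x≢z   = trans (QP.*-zeroʳ (h x))
                       (sym (trans (cong (h z *_) (δ-offdiag (x≢z ∘ sym))) (QP.*-zeroʳ (h z))))

∑-δ : ∀ {n} (x : Fin n) (h : Fin n → ℚ) → ∑ (λ z → δ x z * h z) ≡ h x
∑-δ {suc n} zero h = begin
  1ℚ * h zero + ∑ (λ z → 0ℚ * h (suc z))  ≡⟨ cong (1ℚ * h zero +_) (trans (∑-cong (QP.*-zeroˡ ∘ h ∘ suc)) (∑-zero n)) ⟩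
  1ℚ * h zero + 0ℚ                        ≡⟨ solve 1 (λ a → con 1ℚ :* a :+ con 0ℚ := a) refl (h zero) ⟩
  h zero                                  ∎
  where open ≡-Reasoning
∑-δ {suc n} (suc x) h = begin
  0ℚ * h zero + ∑ (λ z → δ (suc x) (suc z) * h (suc z))
    ≡⟨ cong (0ℚ * h zero +_) (∑-cong (λ z → cong (_* h (suc z)) (δ-suc x z))) ⟩
  0ℚ * h zero + ∑ (λ z → δ x z * h (suc z))
    ≡⟨ cong (0ℚ * h zero +_) (∑-δ x (h ∘ suc)) ⟩
  0ℚ * h zero + h (suc x)
    ≡⟨ solve 2 (λ a b → con 0ℚ :* a :+ b := b) refl (h zero) (h (suc x)) ⟩
  h (suc x)
    ∎
  where open ≡-Reasoning

∑-δ′ : ∀ {n} (x : Fin n) (h : Fin n → ℚ) → ∑ (λ z → h z * δ z x) ≡ h x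
∑-δ′ x h = trans (∑-cong (λ z → trans (QP.*-comm (h z) (δ z x)) (cong (_* h z) (δ-sym z x)))) (∑-δ x h)

∑δ≡1 : ∀ {n} (y : Fin n) → ∑ (δ y) ≡ 1ℚ
∑δ≡1 y = trans (∑-cong (λ x → sym (QP.*-identityʳ (δ y x)))) (∑-δ y (λ _ → 1ℚ))

∑-*δ : ∀ {n} (a : ℚ) (y : Fin n) → ∑ (λ z → a * δ y z) ≡ a
∑-*δ a y = trans (∑-*ˡ a (δ y)) (trans (cong (a *_) (∑δ≡1 y)) (QP.*-identityʳ a))

⊗-congˡ : ∀ {n} {M M′ : Matrix n} (B : Matrix n) → M ≐ M′ → M ⊗ B ≐ M′ ⊗ B
⊗-congˡ B M≐M′ x y = ∑-cong (λ z → cong (_* B z y) (M≐M′ x z))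

⊗-congʳ : ∀ {n} (M : Matrix n) {B B′ : Matrix n} → B ≐ B′ → M ⊗ B ≐ M ⊗ B′
⊗-congʳ M B≐B′ x y = ∑-cong (λ z → cong (M x z *_) (B≐B′ z y))

⊗-assoc : ∀ {n} (M B C : Matrix n) → (M ⊗ B) ⊗ C ≐ M ⊗ (B ⊗ C)
⊗-assoc M B C x y = begin
  ∑ (λ z → ∑ (λ w → M x w * B w z) * C z y)
    ≡⟨ ∑-cong (λ z → sym (∑-*ʳ (C z y) (λ w → M x w * B w z))) ⟩
  ∑ (λ z → ∑ (λ w → M x w * B w z * C z y))
    ≡⟨ ∑-comm (λ z w → M x w * B w z * C z y) ⟩
  ∑ (λ w → ∑ (λ z → M x w * B w z * C z y))
    ≡⟨ ∑-cong (λ w → trans (∑-cong (λ z → QP.*-assoc (M x w) (B w z) (C z y))) (∑-*ˡ (M x w) (λ z → B w z * C z y))) ⟩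
  ∑ (λ w → M x w * ∑ (λ z → B w z * C z y))
    ∎
  where open ≡-Reasoning

columnSum-⊗≡0 : ∀ {n} (M B : Matrix n) → (∀ w → ∑ (λ x → M x w) ≡ 0ℚ) →
                ∀ y → ∑ (λ x → (M ⊗ B) x y) ≡ 0ℚ
columnSum-⊗≡0 {n} M B columnSum-M y = begin
  ∑ (λ x → ∑ (λ w → M x w * B w y))  ≡⟨ ∑-comm (λ x w → M x w * B w y) ⟩
  ∑ (λ w → ∑ (λ x → M x w * B w y))  ≡⟨ ∑-cong (λ w → trans (∑-*ʳ (B w y) (λ x → M x w))
                                                 (trans (cong (_* B w y) (columnSum-M w)) (QP.*-zeroˡ (B w y)))) ⟩
  ∑ {n} (λ _ → 0ℚ)                   ≡⟨ ∑-zero n ⟩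
  0ℚ                                 ∎
  where open ≡-Reasoning

==⇒≡ : ∀ {n} {x y : Fin n} → (x == y) ≡ true → x ≡ y
==⇒≡ {x = x} {y} x=y with x ≟ y
... | yes x≡y = x≡y

anyFin-witness : ∀ {n} (p : Fin n → Bool) → anyFin p ≡ true → ∃ λ i → p i ≡ true
anyFin-witness {suc n} p h with p zero in p0
... | true  = zero , p0
... | false = let i , pi = anyFin-witness (p ∘ suc) h in suc i , pi

Within-suc⁻¹ : ∀ {n} (G : Graph n) k {x z} → Within G (suc k) x z ≡ true →
               Within G k x z ≡ true ⊎ ∃ λ w → Within G k x w ≡ true × adj G w z ≡ true
Within-suc⁻¹ G k {x} {z} h with Within G k x z
... | true  = inj₁ refl
... | false = let w , hw = anyFin-witness (λ w → Within G k x w ∧ adj G w z) h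
              in inj₂ (w , ∧-conicalˡ _ _ hw , ∧-conicalʳ _ _ hw)

adj⇒≢ : ∀ {n} (G : Graph n) {x z : Fin n} → adj G x z ≡ true → x ≢ z
adj⇒≢ G {x} x~z refl with trans (sym (Graph.irrefl G x)) x~z
... | ()

has-neighbour : ∀ {n} (G : Graph n) {x z : Fin n} → x ≢ z → ∀ k → Within G k x z ≡ true →
                ∃ λ w → adj G x w ≡ true
has-neighbour G x≢z zero    x=z = contradiction (==⇒≡ x=z) x≢z
has-neighbour G {x} x≢z (suc k) h with Within-suc⁻¹ G k h
... | inj₁ x≈z = has-neighbour G x≢z k x≈z
... | inj₂ (v , x≈v , v~z) with x ≟ v
...   | yes refl = _ , v~z
...   | no x≢v   = has-neighbour G x≢v k x≈v

-- The Laplacian quadratic form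

module LaplacianForm {n : ℕ} (G : Graph n) where

  A : Matrix n
  A x z = 𝟙 (adj G x z)

  A-sym : ∀ x z → A x z ≡ A z x
  A-sym x z = cong 𝟙 (Graph.sym G x z)

  deg : Fin n → ℚ
  deg x = ι (degree G x)

  deg≡∑A : ∀ x → deg x ≡ ∑ (A x)
  deg≡∑A x = ι-count (adj G x)

  ∑-*A : ∀ a x → ∑ (λ z → a * A x z) ≡ a * deg x
  ∑-*A a x = trans (∑-*ˡ a (A x)) (cong (a *_) (sym (deg≡∑A x)))

  L : Matrix n
  L = Laplacian G

  L≡degδ-A : ∀ x z → L x z ≡ deg x * δ x z - A x z
  L≡degδ-A x z with x ≟ z
  ... | yes refl rewrite Graph.irrefl G x = solve 1 (λ a → a := a :* con 1ℚ :- con 0ℚ) refl (deg x)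
  ... | no _ with adj G x z
  ...   | true  = solve 1 (λ a → :- con 1ℚ := a :* con 0ℚ :- con 1ℚ) refl (deg x)
  ...   | false = solve 1 (λ a → con 0ℚ := a :* con 0ℚ :- con 0ℚ) refl (deg x)

  L-sym : ∀ x z → L x z ≡ L z x
  L-sym x z = begin
    L x z                   ≡⟨ L≡degδ-A x z ⟩
    deg x * δ x z - A x z   ≡⟨ cong₂ _-_ (*-δ-sym deg x z) (A-sym x z) ⟩
    deg z * δ z x - A z x   ≡⟨ L≡degδ-A z x ⟨
    L z x                   ∎
    where open ≡-Reasoning

  laplace : (Fin n → ℚ) → Fin n → ℚ
  laplace v x = ∑ (λ z → L x z * v z)

  laplace≡deg-∑A : ∀ v x → laplace v x ≡ deg x * v x - ∑ (λ z → A x z * v z)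
  laplace≡deg-∑A v x = begin
    ∑ (λ z → L x z * v z)
      ≡⟨ ∑-cong (λ z → cong (_* v z) (L≡degδ-A x z)) ⟩
    ∑ (λ z → (deg x * δ x z - A x z) * v z)
      ≡⟨ ∑-cong (λ z → solve 4 (λ a e b w → (a :* e :- b) :* w := a :* (e :* w) :- b :* w)
                               refl (deg x) (δ x z) (A x z) (v z)) ⟩
    ∑ (λ z → deg x * (δ x z * v z) - A x z * v z)
      ≡⟨ ∑-sub (λ z → deg x * (δ x z * v z)) Av ⟩
    ∑ (λ z → deg x * (δ x z * v z)) - ∑ Av
      ≡⟨ cong (_- ∑ Av) (trans (∑-*ˡ (deg x) (λ z → δ x z * v z)) (cong (deg x *_) (∑-δ x v))) ⟩
    deg x * v x - ∑ Av
      ∎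
    where
    open ≡-Reasoning
    Av : Fin n → ℚ
    Av z = A x z * v z

  laplace≡∑A[v-v] : ∀ v x → laplace v x ≡ ∑ (λ z → A x z * (v x - v z))
  laplace≡∑A[v-v] v x = begin
    laplace v x                                ≡⟨ laplace≡deg-∑A v x ⟩
    deg x * v x - ∑ Av                         ≡⟨ cong (λ a → a * v x - ∑ Av) (deg≡∑A x) ⟩
    ∑ (A x) * v x - ∑ Av                       ≡⟨ cong (_- ∑ Av) (∑-*ʳ (v x) (A x)) ⟨
    ∑ (λ z → A x z * v x) - ∑ Av               ≡⟨ ∑-sub (λ z → A x z * v x) Av ⟨
    ∑ (λ z → A x z * v x - A x z * v z)        ≡⟨ ∑-cong (λ z → solve 3 (λ a p q → a :* p :- a :* q := a :* (p :- q))
                                                                          refl (A x z) (v x) (v z)) ⟩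
    ∑ (λ z → A x z * (v x - v z))              ∎
    where
    open ≡-Reasoning
    Av : Fin n → ℚ
    Av z = A x z * v z

  laplace-sub : ∀ f g x → laplace (λ z → f z - g z) x ≡ laplace f x - laplace g x
  laplace-sub f g x =
    trans (∑-cong (λ z → solve 3 (λ a b c → a :* (b :- c) := a :* b :- a :* c) refl (L x z) (f z) (g z)))
          (∑-sub (λ z → L x z * f z) (λ z → L x z * g z))

  laplace-* : ∀ a f x → laplace (λ z → a * f z) x ≡ a * laplace f x
  laplace-* a f x = trans (∑-cong (λ z → solve 3 (λ l b c → l :* (b :* c) := b :* (l :* c)) refl (L x z) a (f z)))
                          (∑-*ˡ a (λ z → L x z * f z))

  form : (Fin n → ℚ) → (Fin n → ℚ) → ℚ
  form u v = ∑ (λ x → u x * laplace v x)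

  form-sym : ∀ u v → form u v ≡ form v u
  form-sym u v = begin
    ∑ (λ x → u x * ∑ (λ z → L x z * v z))    ≡⟨ ∑-cong (λ x → sym (∑-*ˡ (u x) (λ z → L x z * v z))) ⟩
    ∑ (λ x → ∑ (λ z → u x * (L x z * v z)))  ≡⟨ ∑-comm (λ x z → u x * (L x z * v z)) ⟩
    ∑ (λ z → ∑ (λ x → u x * (L x z * v z)))  ≡⟨ ∑-cong (λ z → ∑-cong (λ x → swap z x)) ⟩
    ∑ (λ z → ∑ (λ x → v z * (L z x * u x)))  ≡⟨ ∑-cong (λ z → ∑-*ˡ (v z) (λ x → L z x * u x)) ⟩
    ∑ (λ z → v z * ∑ (λ x → L z x * u x))    ∎
    where
    open ≡-Reasoning
    swap : ∀ z x → u x * (L x z * v z) ≡ v z * (L z x * u x)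
    swap z x = trans (cong (λ a → u x * (a * v z)) (L-sym x z))
                     (solve 3 (λ a b c → a :* (b :* c) := c :* (b :* a)) refl (u x) (L z x) (v z))

  form-expand : ∀ f g l → form (λ z → f z - l * g z) (λ z → f z - l * g z)
                          ≡ form f f - (l * form f g + l * form f g) + l * l * form g g
  form-expand f g l = begin
    ∑ (λ x → (f x - l * g x) * laplace (λ z → f z - l * g z) x)
      ≡⟨ ∑-cong (λ x → cong ((f x - l * g x) *_)
                            (trans (laplace-sub f (λ z → l * g z) x) (cong (λ a → Lf x - a) (laplace-* l g x)))) ⟩
    ∑ (λ x → (f x - l * g x) * (Lf x - l * Lg x))
      ≡⟨ ∑-cong (λ x → solve 5 (λ a b c e m → (a :- m :* b) :* (c :- m :* e)
                                              := (a :* c :- m :* (a :* e)) :- m :* (b :* c) :+ m :* m :* (b :* e))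
                               refl (f x) (g x) (Lf x) (Lg x) l) ⟩
    ∑ (λ x → (f x * Lf x - l * (f x * Lg x)) - l * (g x * Lf x) + l * l * (g x * Lg x))
      ≡⟨ ∑-+ (λ x → (f x * Lf x - l * (f x * Lg x)) - l * (g x * Lf x)) (λ x → l * l * (g x * Lg x)) ⟩
    ∑ (λ x → (f x * Lf x - l * (f x * Lg x)) - l * (g x * Lf x)) + ∑ (λ x → l * l * (g x * Lg x))
      ≡⟨ cong₂ _+_ (trans (∑-sub (λ x → f x * Lf x - l * (f x * Lg x)) (λ x → l * (g x * Lf x)))
                     (cong₂ _-_ (trans (∑-sub (λ x → f x * Lf x) (λ x → l * (f x * Lg x)))
                                       (cong (λ a → form f f - a) (∑-*ˡ l (λ x → f x * Lg x))))
                                (∑-*ˡ l (λ x → g x * Lf x))))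
                   (∑-*ˡ (l * l) (λ x → g x * Lg x)) ⟩
    form f f - l * form f g - l * form g f + l * l * form g g
      ≡⟨ cong (λ a → form f f - l * form f g - l * a + l * l * form g g) (form-sym g f) ⟩
    form f f - l * form f g - l * form f g + l * l * form g g
      ≡⟨ solve 4 (λ a b c m → a :- m :* b :- m :* b :+ m :* m :* c := a :- (m :* b :+ m :* b) :+ m :* m :* c)
                 refl (form f f) (form f g) (form g g) l ⟩
    form f f - (l * form f g + l * form f g) + l * l * form g g
      ∎
    where
    open ≡-Reasoning
    Lf Lg : Fin n → ℚ
    Lf = laplace f
    Lg = laplace g

  energy : (Fin n → ℚ) → ℚ
  energy w = ∑ (λ x → ∑ (λ z → A x z * ((w x - w z) * (w x - w z))))

  form+form≡energy : ∀ w → form w w + form w w ≡ energy w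
  form+form≡energy w = begin
    form w w + form w w
      ≡⟨ cong₂ _+_ form≡∑∑F (trans form≡∑∑F (∑-comm F)) ⟩
    ∑ (λ x → ∑ (F x)) + ∑ (λ x → ∑ (λ z → F z x))
      ≡⟨ ∑-+ (λ x → ∑ (F x)) (λ x → ∑ (λ z → F z x)) ⟨
    ∑ (λ x → ∑ (F x) + ∑ (λ z → F z x))
      ≡⟨ ∑-cong (λ x → sym (∑-+ (F x) (λ z → F z x))) ⟩
    ∑ (λ x → ∑ (λ z → F x z + F z x))
      ≡⟨ ∑-cong (λ x → ∑-cong (λ z → F+F x z)) ⟩
    energy w
      ∎
    where
    open ≡-Reasoning
    F : Fin n → Fin n → ℚ
    F x z = w x * (A x z * (w x - w z))
    form≡∑∑F : form w w ≡ ∑ (λ x → ∑ (F x))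
    form≡∑∑F = ∑-cong (λ x → trans (cong (w x *_) (laplace≡∑A[v-v] w x))
                                   (sym (∑-*ˡ (w x) (λ z → A x z * (w x - w z)))))
    F+F : ∀ x z → F x z + F z x ≡ A x z * ((w x - w z) * (w x - w z))
    F+F x z = trans (cong (λ a → F x z + w z * (a * (w z - w x))) (A-sym z x))
      (solve 3 (λ a p q → p :* (a :* (p :- q)) :+ q :* (a :* (q :- p)) := a :* ((p :- q) :* (p :- q)))
               refl (A x z) (w x) (w z))

  energy-term-nonNeg : ∀ (w : Fin n → ℚ) x z → 0ℚ ≤ A x z * ((w x - w z) * (w x - w z))
  energy-term-nonNeg w x z = *-nonNeg (𝟙-nonNeg (adj G x z)) (0≤x*x (w x - w z))

  form-nonNeg : ∀ w → 0ℚ ≤ form w w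
  form-nonNeg w = subst (0ℚ ≤_) (solve 1 (λ a → con ½ :* (a :+ a) := a) refl (form w w))
    (*-nonNeg (QP.nonNegative⁻¹ ½) (subst (0ℚ ≤_) (sym (form+form≡energy w))
      (∑-nonNeg (λ x → ∑-nonNeg (energy-term-nonNeg w x)))))

  module _ {v : Fin n → ℚ} (harmonic : ∀ x → laplace v x ≡ 0ℚ) where

    harmonic-adj⇒≡ : ∀ x z → adj G x z ≡ true → v x ≡ v z
    harmonic-adj⇒≡ x z x~z = begin
      v x                ≡⟨ solve 2 (λ a b → a := (a :- b) :+ b) refl (v x) (v z) ⟩
      (v x - v z) + v z  ≡⟨ cong (_+ v z) (x*x≡0⇒x≡0 (v x - v z) square≡0) ⟩
      0ℚ + v z           ≡⟨ QP.+-identityˡ (v z) ⟩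
      v z                ∎
      where
      open ≡-Reasoning
      form≡0 : form v v ≡ 0ℚ
      form≡0 = trans (∑-cong (λ w → trans (cong (v w *_) (harmonic w)) (QP.*-zeroʳ (v w)))) (∑-zero n)
      energy≡0 : energy v ≡ 0ℚ
      energy≡0 = begin
        energy v             ≡⟨ form+form≡energy v ⟨
        form v v + form v v  ≡⟨ cong (λ a → a + a) form≡0 ⟩
        0ℚ + 0ℚ              ≡⟨ QP.+-identityˡ 0ℚ ⟩
        0ℚ                   ∎
      square≡0 : (v x - v z) * (v x - v z) ≡ 0ℚ
      square≡0 = begin
        (v x - v z) * (v x - v z)            ≡⟨ QP.*-identityˡ ((v x - v z) * (v x - v z)) ⟨
        1ℚ * ((v x - v z) * (v x - v z))     ≡⟨ cong (λ b → 𝟙 b * ((v x - v z) * (v x - v z))) x~z ⟨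
        A x z * ((v x - v z) * (v x - v z))  ≡⟨ ∑-nonNeg-≡0 (energy-term-nonNeg v x) row≡0 z ⟩
        0ℚ                                   ∎
        where
        row≡0 : ∑ (λ z → A x z * ((v x - v z) * (v x - v z))) ≡ 0ℚ
        row≡0 = ∑-nonNeg-≡0 (λ w → ∑-nonNeg (energy-term-nonNeg v w)) energy≡0 x

    harmonic-within⇒≡ : ∀ k x z → Within G k x z ≡ true → v x ≡ v z
    harmonic-within⇒≡ zero    x z x=z = cong v (==⇒≡ x=z)
    harmonic-within⇒≡ (suc k) x z h with Within-suc⁻¹ G k h
    ... | inj₁ x≈z             = harmonic-within⇒≡ k x z x≈z
    ... | inj₂ (w , x≈w , w~z) = trans (harmonic-within⇒≡ k x w x≈w) (harmonic-adj⇒≡ w z w~z)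

    harmonic⇒constant : Connected G → ∀ x z → v x ≡ v z
    harmonic⇒constant connected x z = let k , x≈z = connected x z in harmonic-within⇒≡ k x z x≈z

-- The group inverse of the Laplacian

module GroupInverse {n : ℕ} (G : Graph n) (connected : Connected G)
                    {X : Matrix n} (isGroupInverse : IsGroupInverse (Laplacian G) X) where

  open LaplacianForm G

  P : Matrix n
  P = L ⊗ X

  PL≐L : P ⊗ L ≐ L
  PL≐L = proj₁ isGroupInverse

  LX≐XL : L ⊗ X ≐ X ⊗ L
  LX≐XL = proj₂ (proj₂ isGroupInverse)

  LP≐L : L ⊗ P ≐ L
  LP≐L x y = trans (⊗-congʳ L LX≐XL x y) (trans (sym (⊗-assoc L X L x y)) (PL≐L x y))

  PX≐X : P ⊗ X ≐ X
  PX≐X x y = trans (⊗-congˡ X LX≐XL x y) (proj₁ (proj₂ isGroupInverse) x y)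

  columnSum-L : ∀ z → ∑ (λ x → L x z) ≡ 0ℚ
  columnSum-L z = begin
    ∑ (λ x → L x z)               ≡⟨ ∑-cong (λ x → trans (L-sym x z) (sym (QP.*-identityʳ (L z x)))) ⟩
    laplace (λ _ → 1ℚ) z          ≡⟨ laplace≡∑A[v-v] (λ _ → 1ℚ) z ⟩
    ∑ (λ x → A z x * (1ℚ - 1ℚ))   ≡⟨ ∑-cong (λ x → cong (A z x *_) (QP.+-inverseʳ 1ℚ)) ⟩
    ∑ (λ x → A z x * 0ℚ)          ≡⟨ ∑-cong (λ x → QP.*-zeroʳ (A z x)) ⟩
    ∑ {n} (λ _ → 0ℚ)              ≡⟨ ∑-zero n ⟩
    0ℚ                            ∎
    where open ≡-Reasoning

  columnSum-P : ∀ y → ∑ (λ x → P x y) ≡ 0ℚ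
  columnSum-P = columnSum-⊗≡0 L X columnSum-L

  columnSum-X : ∀ y → ∑ (λ x → X x y) ≡ 0ℚ
  columnSum-X y = trans (∑-cong (λ x → sym (PX≐X x y))) (columnSum-⊗≡0 P X columnSum-P y)

  E : Matrix n
  E x y = δ x y - P x y

  E-column-harmonic : ∀ y x → laplace (λ z → E z y) x ≡ 0ℚ
  E-column-harmonic y x = begin
    laplace (λ z → δ z y - P z y) x                    ≡⟨ laplace-sub (λ z → δ z y) (λ z → P z y) x ⟩
    ∑ (λ z → L x z * δ z y) - (L ⊗ P) x y              ≡⟨ cong₂ _-_ (∑-δ′ y (L x)) (LP≐L x y) ⟩
    L x y - L x y                                      ≡⟨ QP.+-inverseʳ (L x y) ⟩
    0ℚ                                                 ∎
    where open ≡-Reasoning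

  E-row-harmonic : ∀ x w → laplace (E x) w ≡ 0ℚ
  E-row-harmonic x w = begin
    laplace (λ z → δ x z - P x z) w
      ≡⟨ laplace-sub (δ x) (P x) w ⟩
    ∑ (λ z → L w z * δ x z) - ∑ (λ z → L w z * P x z)
      ≡⟨ cong₂ _-_ (∑-cong (λ z → QP.*-comm (L w z) (δ x z)))
                   (∑-cong (λ z → trans (QP.*-comm (L w z) (P x z)) (cong (P x z *_) (L-sym w z)))) ⟩
    ∑ (λ z → δ x z * L w z) - (P ⊗ L) x w
      ≡⟨ cong₂ _-_ (trans (∑-δ x (L w)) (L-sym w x)) (PL≐L x w) ⟩
    L x w - L x w
      ≡⟨ QP.+-inverseʳ (L x w) ⟩
    0ℚ
      ∎
    where open ≡-Reasoning

  E-constant : ∀ x y x′ y′ → E x y ≡ E x′ y′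
  E-constant x y x′ y′ = trans (harmonic⇒constant (E-column-harmonic y) connected x x′)
                               (harmonic⇒constant (E-row-harmonic x′) connected y y′)

  n*E≡1 : ∀ x y → ι n * E x y ≡ 1ℚ
  n*E≡1 x y = begin
    ι n * E x y                            ≡⟨ ∑-const n (E x y) ⟨
    ∑ {n} (λ _ → E x y)                    ≡⟨ ∑-cong (λ x′ → E-constant x y x′ y) ⟩
    ∑ (λ x′ → δ x′ y - P x′ y)             ≡⟨ ∑-sub (λ x′ → δ x′ y) (λ x′ → P x′ y) ⟩
    ∑ (λ x′ → δ x′ y) - ∑ (λ x′ → P x′ y)  ≡⟨ cong₂ _-_ (trans (∑-cong (λ x′ → δ-sym x′ y)) (∑δ≡1 y))
                                                          (columnSum-P y) ⟩
    1ℚ - 0ℚ                                ≡⟨ QP.+-identityʳ 1ℚ ⟩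
    1ℚ                                     ∎
    where open ≡-Reasoning

  green : Fin n → Fin n → ℚ
  green y z = ι n * X z y

  laplace-green : ∀ y x → laplace (green y) x ≡ ι n * δ x y - 1ℚ
  laplace-green y x = begin
    laplace (λ z → ι n * X z y) x  ≡⟨ laplace-* (ι n) (λ z → X z y) x ⟩
    ι n * P x y                    ≡⟨ solve 3 (λ m e p → m :* p := m :* e :- m :* (e :- p))
                                               refl (ι n) (δ x y) (P x y) ⟩
    ι n * δ x y - ι n * E x y      ≡⟨ cong (λ a → ι n * δ x y - a) (n*E≡1 x y) ⟩
    ι n * δ x y - 1ℚ               ∎
    where open ≡-Reasoning

  form-green : ∀ u y → form u (green y) ≡ ι n * u y - ∑ u
  form-green u y = begin
    ∑ (λ x → u x * laplace (green y) x)
      ≡⟨ ∑-cong (λ x → trans (cong (u x *_) (laplace-green y x))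
                             (solve 3 (λ a m e → a :* (m :* e :- con 1ℚ) := m :* (a :* e) :- a) refl (u x) (ι n) (δ x y))) ⟩
    ∑ (λ x → ι n * (u x * δ x y) - u x)
      ≡⟨ ∑-sub (λ x → ι n * (u x * δ x y)) u ⟩
    ∑ (λ x → ι n * (u x * δ x y)) - ∑ u
      ≡⟨ cong (_- ∑ u) (trans (∑-*ˡ (ι n) (λ x → u x * δ x y)) (cong (ι n *_) (∑-δ′ y u))) ⟩
    ι n * u y - ∑ u
      ∎
    where open ≡-Reasoning

  form-green-green : ∀ y → form (green y) (green y) ≡ ι n * green y y
  form-green-green y = begin
    form (green y) (green y)       ≡⟨ form-green (green y) y ⟩
    ι n * green y y - ∑ (green y)  ≡⟨ cong (λ a → ι n * green y y - a) ∑-green≡0 ⟩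
    ι n * green y y - 0ℚ           ≡⟨ QP.+-identityʳ _ ⟩
    ι n * green y y                ∎
    where
    open ≡-Reasoning
    ∑-green≡0 : ∑ (green y) ≡ 0ℚ
    ∑-green≡0 = trans (∑-*ˡ (ι n) (λ z → X z y)) (trans (cong (ι n *_) (columnSum-X y)) (QP.*-zeroʳ (ι n)))

-- Star vectors

module Star {n : ℕ} (G : Graph n) (y : Fin n) {k₀ : ℕ}
            (neighbour-degree : ∀ x → adj G y x ≡ true → degree G x ≡ k₀)
            (neighbours-independent : ∀ x z → adj G y x ≡ true → adj G y z ≡ true → adj G x z ≡ false) where

  open LaplacianForm G

  star : ℚ → ℚ → Fin n → ℚ
  star t₀ t₁ z = t₀ * δ y z + t₁ * A y z

  star-y : ∀ t₀ t₁ → star t₀ t₁ y ≡ t₀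
  star-y t₀ t₁ = trans (cong₂ (λ a b → t₀ * a + t₁ * 𝟙 b) (δ-diag y) (Graph.irrefl G y))
                       (solve 2 (λ a b → a :* con 1ℚ :+ b :* con 0ℚ := a) refl t₀ t₁)

  star-neighbour : ∀ t₀ t₁ x → adj G y x ≡ true → star t₀ t₁ x ≡ t₁
  star-neighbour t₀ t₁ x y~x = trans (cong₂ (λ a b → t₀ * a + t₁ * 𝟙 b) (δ-offdiag (adj⇒≢ G y~x)) y~x)
                                     (solve 2 (λ a b → a :* con 0ℚ :+ b :* con 1ℚ := b) refl t₀ t₁)

  ∑-star : ∀ t₀ t₁ → ∑ (star t₀ t₁) ≡ t₀ + t₁ * deg y
  ∑-star t₀ t₁ = trans (∑-+ (λ z → t₀ * δ y z) (λ z → t₁ * A y z)) (cong₂ _+_ (∑-*δ t₀ y) (∑-*A t₁ y))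

  laplace-star-y : ∀ t₀ t₁ → laplace (star t₀ t₁) y ≡ deg y * (t₀ - t₁)
  laplace-star-y t₀ t₁ = begin
    laplace (star t₀ t₁) y
      ≡⟨ laplace≡deg-∑A (star t₀ t₁) y ⟩
    deg y * star t₀ t₁ y - ∑ (λ z → A y z * star t₀ t₁ z)
      ≡⟨ cong₂ (λ a b → deg y * a - b) (star-y t₀ t₁) (trans (∑-cong A*star) (∑-*A t₁ y)) ⟩
    deg y * t₀ - t₁ * deg y
      ≡⟨ solve 3 (λ k a b → k :* a :- b :* k := k :* (a :- b)) refl (deg y) t₀ t₁ ⟩
    deg y * (t₀ - t₁)
      ∎
    where
    open ≡-Reasoning
    A*star : ∀ z → A y z * star t₀ t₁ z ≡ t₁ * A y z
    A*star z with adj G y z in y~z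
    ... | true  = trans (cong (λ e → 1ℚ * (t₀ * e + t₁ * 1ℚ)) (δ-offdiag (adj⇒≢ G y~z)))
                        (solve 2 (λ a b → con 1ℚ :* (a :* con 0ℚ :+ b :* con 1ℚ) := b :* con 1ℚ) refl t₀ t₁)
    ... | false = trans (QP.*-zeroˡ (t₀ * δ y z + t₁ * 0ℚ)) (sym (QP.*-zeroʳ t₁))

  laplace-star-neighbour : ∀ t₀ t₁ x → adj G y x ≡ true → laplace (star t₀ t₁) x ≡ ι k₀ * t₁ - t₀
  laplace-star-neighbour t₀ t₁ x y~x = begin
    laplace (star t₀ t₁) x
      ≡⟨ laplace≡deg-∑A (star t₀ t₁) x ⟩
    deg x * star t₀ t₁ x - ∑ (λ z → A x z * star t₀ t₁ z)
      ≡⟨ cong₂ _-_ (cong₂ _*_ (cong ι (neighbour-degree x y~x)) (star-neighbour t₀ t₁ x y~x))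
                   (trans (∑-cong A*star) (∑-*δ t₀ y)) ⟩
    ι k₀ * t₁ - t₀
      ∎
    where
    open ≡-Reasoning
    x~y : adj G x y ≡ true
    x~y = trans (Graph.sym G x y) y~x
    A*star : ∀ z → A x z * star t₀ t₁ z ≡ t₀ * δ y z
    A*star z with adj G x z in x~z | adj G y z in y~z
    ... | true  | true  with () ← trans (sym (neighbours-independent x z y~x y~z)) x~z
    ... | true  | false = solve 3 (λ a b e → con 1ℚ :* (a :* e :+ b :* con 0ℚ) := a :* e) refl t₀ t₁ (δ y z)
    ... | false | b     = trans (QP.*-zeroˡ (t₀ * δ y z + t₁ * 𝟙 b))
                                (sym (trans (cong (t₀ *_) (δ-offdiag y≢z)) (QP.*-zeroʳ t₀)))
      where
      y≢z : y ≢ z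
      y≢z refl with () ← trans (sym x~z) x~y

  form-star : ∀ t₀ t₁ → form (star t₀ t₁) (star t₀ t₁)
                        ≡ deg y * ((t₀ - t₁) * (t₀ - t₁) + (ι k₀ - 1ℚ) * t₁ * t₁)
  form-star t₀ t₁ = begin
    ∑ (λ x → (t₀ * δ y x + t₁ * A y x) * Ls x)
      ≡⟨ ∑-cong (λ x → solve 5 (λ a b e f l → (a :* e :+ b :* f) :* l := a :* (e :* l) :+ b :* (f :* l))
                               refl t₀ t₁ (δ y x) (A y x) (Ls x)) ⟩
    ∑ (λ x → t₀ * (δ y x * Ls x) + t₁ * (A y x * Ls x))
      ≡⟨ ∑-linear t₀ t₁ (λ x → δ y x * Ls x) (λ x → A y x * Ls x) ⟩
    t₀ * ∑ (λ x → δ y x * Ls x) + t₁ * ∑ (λ x → A y x * Ls x)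
      ≡⟨ cong₂ (λ a b → t₀ * a + t₁ * b) (trans (∑-δ y Ls) (laplace-star-y t₀ t₁))
                                         (trans (∑-cong A*Ls) (∑-*A (ι k₀ * t₁ - t₀) y)) ⟩
    t₀ * (deg y * (t₀ - t₁)) + t₁ * ((ι k₀ * t₁ - t₀) * deg y)
      ≡⟨ solve 4 (λ a b k m → a :* (k :* (a :- b)) :+ b :* ((m :* b :- a) :* k)
                              := k :* ((a :- b) :* (a :- b) :+ (m :- con 1ℚ) :* b :* b))
                 refl t₀ t₁ (deg y) (ι k₀) ⟩
    deg y * ((t₀ - t₁) * (t₀ - t₁) + (ι k₀ - 1ℚ) * t₁ * t₁)
      ∎
    where
    open ≡-Reasoning
    Ls : Fin n → ℚ
    Ls = laplace (star t₀ t₁)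
    A*Ls : ∀ x → A y x * Ls x ≡ (ι k₀ * t₁ - t₀) * A y x
    A*Ls x with adj G y x in y~x
    ... | true  = trans (QP.*-identityˡ (Ls x)) (trans (laplace-star-neighbour t₀ t₁ x y~x) (sym (QP.*-identityʳ _)))
    ... | false = trans (QP.*-zeroˡ (Ls x)) (sym (QP.*-zeroʳ (ι k₀ * t₁ - t₀)))

-- t₀, t₁ and l are chosen so that K times the hypothesised value of the form is at most
-- −K²(N − 1)·m with m = 2K − 1 + (K₀ + 1)(N − 2K − K₀), which is positive once N ≥ 2K + K₀.
star-green-test-fails : ∀ {N K K₀ u : ℚ} → 1ℚ ≤ K → 0ℚ ≤ K₀ → K + K + K₀ ≤ N → K * u ≤ N - 1ℚ →
  let t₁ = N - 1ℚ
      t₀ = t₁ * (K₀ + 1ℚ)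
      l  = K * K₀
      b  = N * t₀ - (t₀ + t₁ * K)
  in ¬ (0ℚ ≤ K * ((t₀ - t₁) * (t₀ - t₁) + (K₀ - 1ℚ) * t₁ * t₁) - (l * b + l * b) + l * l * (N * u))
star-green-test-fails {N} {K} {K₀} {u} 1≤K 0≤K₀ 2K+K₀≤N Ku≤N-1 0≤Q = QP.<-irrefl refl (begin-strict
  0ℚ                                               ≤⟨ *-nonNeg (QP.<⇒≤ 0<K) 0≤Q ⟩
  K * (S - (l * b + l * b) + l * l * (N * u))      ≡⟨ solve 6 (λ k s c a n w → k :* (s :- c :+ a :* a :* (n :* w))
                                                                            := k :* (s :- c) :+ a :* a :* n :* (k :* w))
                                                              refl K S (l * b + l * b) l N u ⟩
  K * (S - (l * b + l * b)) + l * l * N * (K * u)  ≤⟨ QP.+-monoʳ-≤ (K * (S - (l * b + l * b)))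
                                                        (QP.*-monoˡ-≤-nonNeg (l * l * N) {{nonNegative 0≤l²N}} Ku≤N-1) ⟩
  K * (S - (l * b + l * b)) + l * l * N * t₁       ≡⟨ factorisation ⟩
  - (K * K * t₁ * m)                               <⟨ QP.neg-antimono-< (*-pos (*-pos (*-pos 0<K 0<K) 0<t₁) 0<m) ⟩
  0ℚ                                               ∎)
  where
  open QP.≤-Reasoning
  t₁ t₀ l b S r m : ℚ
  t₁ = N - 1ℚ
  t₀ = t₁ * (K₀ + 1ℚ)
  l  = K * K₀
  b  = N * t₀ - (t₀ + t₁ * K)
  S  = K * ((t₀ - t₁) * (t₀ - t₁) + (K₀ - 1ℚ) * t₁ * t₁)
  r  = N - (K + K + K₀)
  m  = K + ((K - 1ℚ) + (K₀ + 1ℚ) * r)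

  factorisation : K * (S - (l * b + l * b)) + l * l * N * t₁ ≡ - (K * K * t₁ * m)
  factorisation = solve 3
    (λ n k k₀ →
      let t₁ = n :- con 1ℚ
          t₀ = t₁ :* (k₀ :+ con 1ℚ)
          l  = k :* k₀
          b  = n :* t₀ :- (t₀ :+ t₁ :* k)
          s  = k :* ((t₀ :- t₁) :* (t₀ :- t₁) :+ (k₀ :- con 1ℚ) :* t₁ :* t₁)
          m  = k :+ ((k :- con 1ℚ) :+ (k₀ :+ con 1ℚ) :* (n :- (k :+ k :+ k₀)))
      in k :* (s :- (l :* b :+ l :* b)) :+ l :* l :* n :* t₁ := :- (k :* k :* t₁ :* m))
    refl N K K₀

  0<K : 0ℚ < K
  0<K = QP.<-≤-trans (QP.positive⁻¹ 1ℚ) 1≤K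
  0≤K-1 : 0ℚ ≤ K - 1ℚ
  0≤K-1 = ≤⇒0≤- 1≤K
  0≤r : 0ℚ ≤ r
  0≤r = ≤⇒0≤- 2K+K₀≤N
  0≤N : 0ℚ ≤ N
  0≤N = QP.≤-trans (QP.+-mono-≤ (QP.+-mono-≤ (QP.<⇒≤ 0<K) (QP.<⇒≤ 0<K)) 0≤K₀) 2K+K₀≤N
  0≤l²N : 0ℚ ≤ l * l * N
  0≤l²N = *-nonNeg (0≤x*x l) 0≤N
  0<t₁ : 0ℚ < t₁
  0<t₁ = subst (0ℚ <_)
               (solve 3 (λ n k k₀ → k :+ ((k :- con 1ℚ) :+ k₀ :+ (n :- (k :+ k :+ k₀))) := n :- con 1ℚ) refl N K K₀)
               (pos+nonNeg⇒pos 0<K (QP.+-mono-≤ (QP.+-mono-≤ 0≤K-1 0≤K₀) 0≤r))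
  0<m : 0ℚ < m
  0<m = pos+nonNeg⇒pos 0<K (QP.+-mono-≤ 0≤K-1 (*-nonNeg (QP.+-mono-≤ 0≤K₀ (QP.nonNegative⁻¹ 1ℚ)) 0≤r))

neighbourhood-bound : ∀ {n} (G : Graph n) → Connected G → MProperty G → ∀ y {k₀} →
  (∀ x → adj G y x ≡ true → degree G x ≡ k₀) →
  (∀ x z → adj G y x ≡ true → adj G y z ≡ true → adj G x z ≡ false) →
  ∃ (λ w → adj G y w ≡ true) →
  n ℕ.< 2 ℕ.* degree G y ℕ.+ k₀
neighbourhood-bound {n} G connected (X , isGroupInverse , X≤0) y {k₀} neighbour-degree neighbours-independent (w , y~w) =
  ℕP.≰⇒> λ 2k+k₀≤n → star-green-test-fails 1≤K (ι-nonNeg k₀) (ι-mono-bound 2k+k₀≤n) Ku≤N-1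
                       (test-form-nonNeg (t₁ * (ι k₀ + 1ℚ)) t₁ (deg y * ι k₀))
  where
  open LaplacianForm G
  open GroupInverse G connected isGroupInverse
  open Star G y neighbour-degree neighbours-independent

  u : Fin n → ℚ
  u = green y

  t₁ : ℚ
  t₁ = ι n - 1ℚ

  1≤K : 1ℚ ≤ deg y
  1≤K = ι-mono-≤ (count-pos (adj G y) y~w)

  ι-mono-bound : 2 ℕ.* degree G y ℕ.+ k₀ ℕ.≤ n → deg y + deg y + ι k₀ ≤ ι n
  ι-mono-bound 2k+k₀≤n = subst (_≤ ι n) ι[2k+k₀] (ι-mono-≤ 2k+k₀≤n)
    where
    k = degree G y
    ι[2k+k₀] : ι (2 ℕ.* k ℕ.+ k₀) ≡ deg y + deg y + ι k₀
    ι[2k+k₀] = trans (ι-+ (2 ℕ.* k) k₀)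
                     (cong (_+ ι k₀) (trans (ι-+ k (k ℕ.+ 0)) (cong (λ m → ι k + ι m) (ℕP.+-identityʳ k))))

  u≤0 : ∀ z → z ≢ y → u z ≤ 0ℚ
  u≤0 z z≢y = subst (u z ≤_) (QP.*-zeroʳ (ι n))
                (QP.*-monoˡ-≤-nonNeg (ι n) {{nonNegative (ι-nonNeg n)}} (X≤0 z y z≢y))

  Ku≤N-1 : deg y * u y ≤ ι n - 1ℚ
  Ku≤N-1 = begin
    deg y * u y              ≡⟨ solve 2 (λ a s → a := (a :- s) :+ s) refl (deg y * u y) Σ ⟩
    (deg y * u y - Σ) + Σ    ≡⟨ cong (_+ Σ) (sym (laplace≡deg-∑A u y)) ⟩
    laplace u y + Σ          ≤⟨ QP.+-monoʳ-≤ (laplace u y) Σ≤0 ⟩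
    laplace u y + 0ℚ         ≡⟨ QP.+-identityʳ (laplace u y) ⟩
    laplace u y              ≡⟨ laplace-green y y ⟩
    ι n * δ y y - 1ℚ         ≡⟨ cong (λ a → ι n * a - 1ℚ) (δ-diag y) ⟩
    ι n * 1ℚ - 1ℚ            ≡⟨ cong (_- 1ℚ) (QP.*-identityʳ (ι n)) ⟩
    ι n - 1ℚ                 ∎
    where
    open QP.≤-Reasoning
    Σ : ℚ
    Σ = ∑ (λ z → A y z * u z)
    A*u≤0 : ∀ z → A y z * u z ≤ 0ℚ
    A*u≤0 z with adj G y z in y~z
    ... | true  = subst (_≤ 0ℚ) (sym (QP.*-identityˡ (u z))) (u≤0 z (adj⇒≢ G y~z ∘ sym))
    ... | false = QP.≤-reflexive (QP.*-zeroˡ (u z))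
    Σ≤0 : Σ ≤ 0ℚ
    Σ≤0 = subst (Σ ≤_) (∑-zero n) (∑-mono-≤ A*u≤0)

  test-form-nonNeg : ∀ t₀ t₁ l → 0ℚ ≤ deg y * ((t₀ - t₁) * (t₀ - t₁) + (ι k₀ - 1ℚ) * t₁ * t₁)
                                       - (l * (ι n * t₀ - (t₀ + t₁ * deg y)) + l * (ι n * t₀ - (t₀ + t₁ * deg y)))
                                       + l * l * (ι n * u y)
  test-form-nonNeg t₀ t₁ l = subst (0ℚ ≤_) form-h≡ (form-nonNeg h)
    where
    open ≡-Reasoning
    f h : Fin n → ℚ
    f = star t₀ t₁
    h z = f z - l * u z
    S b : ℚ
    S = deg y * ((t₀ - t₁) * (t₀ - t₁) + (ι k₀ - 1ℚ) * t₁ * t₁)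
    b = ι n * t₀ - (t₀ + t₁ * deg y)
    form-f-u : form f u ≡ b
    form-f-u = trans (form-green f y) (cong₂ (λ a s → ι n * a - s) (star-y t₀ t₁) (∑-star t₀ t₁))
    form-h≡ : form h h ≡ S - (l * b + l * b) + l * l * (ι n * u y)
    form-h≡ = begin
      form h h
        ≡⟨ form-expand f u l ⟩
      form f f - (l * form f u + l * form f u) + l * l * form u u
        ≡⟨ cong (λ c → form f f - (l * c + l * c) + l * l * form u u) form-f-u ⟩
      form f f - (l * b + l * b) + l * l * form u u
        ≡⟨ cong₂ (λ a c → a - (l * b + l * b) + l * l * c) (form-star t₀ t₁) (form-green-green y) ⟩
      S - (l * b + l * b) + l * l * (ι n * u y)
        ∎

-- Distance-biregular graphs

other-side : ∀ {a b : Fin 2} → a ≢ b → a ≡ suc zero → b ≡ zero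
other-side {b = zero}     _   _    = refl
other-side {b = suc zero} a≢b refl = contradiction refl a≢b

module _ {n : ℕ} {G : Graph n} {part : Fin n → Fin 2} {k : Fin 2 → ℕ} (dbr : DistanceBiregular G part k) where

  open DistanceBiregular dbr

  V₁-vertex-with-neighbour : ∀ {x z : Fin n} → x ≢ z → ∃ λ y → part y ≡ suc zero × ∃ (λ w → adj G y w ≡ true)
  V₁-vertex-with-neighbour {x} {z} x≢z with has-neighbour G x≢z (proj₁ (connected x z)) (proj₂ (connected x z))
  ... | w , x~w with part x in px | part w in pw
  ...   | suc zero | _        = x , px , w , x~w
  ...   | zero     | suc zero = w , pw , x , trans (Graph.sym G w x) x~w
  ...   | zero     | zero     = contradiction (trans px (sym pw)) (bipartite x w x~w)

  neighbour-in-V₀ : ∀ {y x} → part y ≡ suc zero → adj G y x ≡ true → part x ≡ zero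
  neighbour-in-V₀ py y~x = other-side (bipartite _ _ y~x) py

  V₁-neighbours-independent : ∀ {y} → part y ≡ suc zero →
                              ∀ x z → adj G y x ≡ true → adj G y z ≡ true → adj G x z ≡ false
  V₁-neighbours-independent py x z y~x y~z with adj G x z in x~z
  ... | true  = contradiction (trans (neighbour-in-V₀ py y~x) (sym (neighbour-in-V₀ py y~z))) (bipartite x z x~z)
  ... | false = refl

corollary4p3 : (n : ℕ) → 2 ℕ.≤ n → (G : Graph n) → (part : Fin n → Fin 2) → (k : Fin 2 → ℕ)
    → DistanceBiregular G part k → MProperty G
    → Dmax G part zero ℕ.≤ Dmax G part (suc zero) → 2 ℕ.≤ Dmax G part zero
    → n ℕ.< 2 ℕ.* k (suc zero) ℕ.+ k zero
corollary4p3 zero          ()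
corollary4p3 (suc zero)    (ℕ.s≤s ())
corollary4p3 (suc (suc _)) _ G part k dbr m-property _ _ with V₁-vertex-with-neighbour dbr {zero} {suc zero} (λ ())
... | y , py , y~w = subst (λ k₁ → _ ℕ.< 2 ℕ.* k₁ ℕ.+ k zero) (trans (regular y) (cong k py))
  (neighbourhood-bound G connected m-property y
    (λ x y~x → trans (regular x) (cong k (neighbour-in-V₀ dbr py y~x)))
    (V₁-neighbours-independent dbr py)
    y~w)
  where open DistanceBiregular dbr
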